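{- There is $\alpha\in E$ with $\alpha\prec\omega$ such that $\vdash^\alpha_0\mathsf{Prog}_{\lhd}$, where $\mathsf{Prog}_{\lhd}:\equiv\forall x(\forall y\lhd x.Xy\to Xx)$, i.e. in negation normal form $\forall x(\exists y(y\lhd x\land\neg Xy)\lor Xx)$.
   Context: $\mathcal L_{\mathsf{PA}}$ is the first-order language with $0,S,+,\times,\leq,=$; $\mathcal L^X_{\mathsf{PA}}$ adds a unary relation symbol $X$. Formulas are in negation normal form (built from literals by $\land,\lor,\forall,\exists$), $\neg\varphi$ defined by de Morgan's laws, $\varphi\to\psi$ abbreviates $\neg\varphi\lor\psi$, $\forall y\lhd x.\psi$ abbreviates $\forall y(y\lhd x\to\psi)$. "True" refers to the standard model $\mathbb N$. Rank: literals $0$, $\mathrm{rk}(\varphi_0\land\varphi_1)=\mathrm{rk}(\varphi_0\lor\varphi_1)=\max+1$, $\mathrm{rk}(\forall x\varphi)=\mathrm{rk}(\exists x\varphi)=\mathrm{rk}(\varphi)+1$. $(E,\prec)$ is a well order with a map $\alpha\mapsto\alpha+1$ satisfying $\alpha\prec\alpha+1$, and elements $0,\omega\in E$ with $0\prec\omega$ such that $\alpha\prec\omega$ implies $\alpha+1\prec\omega$. $x\lhd y$ is a fixed $\mathcal L_{\mathsf{PA}}$-formula with free variables $x,y$ only, defining a well order $\lhd$ on $\mathbb N$. A sequent is a finite set of $\mathcal L^X_{\mathsf{PA}}$-sentences; $\Gamma,\varphi$ denotes $\Gamma\cup\{\varphi\}$. By recursion on $\alpha\in E$, $\vdash^\alpha_d\Gamma$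 holds exactly if one of: (i) $\Gamma$ contains a true $\mathcal L_{\mathsf{PA}}$-literal, or $Xs$ and $\neg Xt$ with closed terms $s,t$ of equal value; (ii) $\Gamma$ contains $\varphi_0\land\varphi_1$ (resp. $\varphi_0\lor\varphi_1$) and for every (resp. some) $i\in\{0,1\}$: $\vdash^{\alpha(i)}_{d(i)}\Delta_i$ with $\alpha(i)\prec\alpha$, $d(i)\leq d$, $\Delta_i\subseteq\Gamma,\varphi_i$; (iii) $\Gamma$ contains $\forall x\varphi$ (resp. $\exists x\varphi$) and for every (resp. some) closed term $t$: $\vdash^{\alpha(t)}_{d(t)}\Delta_t$ with $\alpha(t)\prec\alpha$, $d(t)\leq d$, $\Delta_t\subseteq\Gamma,\varphi[x/t]$; (iv) $\Gamma$ contains $Xt$ and for every closed term $s$ with $s\lhd t$ (by value): $\vdash^{\alpha(s)}_{d(s)}\Delta_s$ with $\alpha(s)\prec\alpha$, $d(s)\leq d$, $\Delta_s\subseteq\Gamma,Xs$; (v) for some sentence $\varphi$ with $\mathrm{rk}(\varphi)<d$: $\vdash^{\alpha(0)}_{d(0)}\Delta_0$ and $\vdash^{\alpha(1)}_{d(1)}\Delta_1$ with $\alpha(i)\prec\alpha$, $d(i)\leq d$, $\Delta_0\subseteq\Gamma,\varphi$, $\Delta_1\subseteq\Gamma,\neg\varphi$. -}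

module Defs where

open import Data.Nat using (ℕ; zero; suc; _+_; _*_; _≤_; _<_; _⊔_)
open import Data.Nat.Properties using (_≟_)
open import Data.Bool using (Bool; true; false)
open import Data.Empty using (⊥)
open import Data.Unit using (⊤)
open import Data.Sum using (_⊎_)
open import Data.Product using (Σ; _×_; _,_)
open import Data.List using (List; _∷_; [])
open import Data.List.Membership.Propositional using (_∈_)
open import Data.List.Relation.Binary.Subset.Propositional using (_⊆_)
open import Relation.Nullary using (¬_; yes; no)
open import Relation.Binary.PropositionalEquality using (_≡_)
open import Induction.WellFounded using (WellFounded)

data Term : Set where
  var   : ℕ → Term
  `0    : Term
  `S    : Term → Term
  _`+_  : Term → Term → Term
  _`×_  : Term → Term → Term

-- Formulas in negation normal form
data Formula : Set where
  _`=_  : Term → Term → Formula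
  _`≠_  : Term → Term → Formula
  _`≤_  : Term → Term → Formula
  _`≰_  : Term → Term → Formula
  `X    : Term → Formula
  `¬X   : Term → Formula
  _`∧_  : Formula → Formula → Formula
  _`∨_  : Formula → Formula → Formula
  `∀    : ℕ → Formula → Formula
  `∃    : ℕ → Formula → Formula

neg : Formula → Formula
neg (s `= t) = s `≠ t
neg (s `≠ t) = s `= t
neg (s `≤ t) = s `≰ t
neg (s `≰ t) = s `≤ t
neg (`X t)   = `¬X t
neg (`¬X t)  = `X t
neg (φ `∧ ψ) = neg φ `∨ neg ψ
neg (φ `∨ ψ) = neg φ `∧ neg ψ
neg (`∀ x φ) = `∃ x (neg φ)
neg (`∃ x φ) = `∀ x (neg φ)

rk : Formula → ℕ
rk (φ `∧ ψ) = suc (rk φ ⊔ rk ψ)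
rk (φ `∨ ψ) = suc (rk φ ⊔ rk ψ)
rk (`∀ x φ) = suc (rk φ)
rk (`∃ x φ) = suc (rk φ)
rk _        = 0

data IsLiteral : Formula → Set where
  lit-=  : ∀ {s t} → IsLiteral (s `= t)
  lit-≠  : ∀ {s t} → IsLiteral (s `≠ t)
  lit-≤  : ∀ {s t} → IsLiteral (s `≤ t)
  lit-≰  : ∀ {s t} → IsLiteral (s `≰ t)
  lit-X  : ∀ {t} → IsLiteral (`X t)
  lit-¬X : ∀ {t} → IsLiteral (`¬X t)

NoX : Formula → Set
NoX (`X t)   = ⊥
NoX (`¬X t)  = ⊥
NoX (φ `∧ ψ) = NoX φ × NoX ψ
NoX (φ `∨ ψ) = NoX φ × NoX ψ
NoX (`∀ x φ) = NoX φ
NoX (`∃ x φ) = NoX φ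
NoX _        = ⊤

OccT : ℕ → Term → Set
OccT v (var w)  = v ≡ w
OccT v `0       = ⊥
OccT v (`S t)   = OccT v t
OccT v (s `+ t) = OccT v s ⊎ OccT v t
OccT v (s `× t) = OccT v s ⊎ OccT v t

FreeIn : ℕ → Formula → Set
FreeIn v (s `= t) = OccT v s ⊎ OccT v t
FreeIn v (s `≠ t) = OccT v s ⊎ OccT v t
FreeIn v (s `≤ t) = OccT v s ⊎ OccT v t
FreeIn v (s `≰ t) = OccT v s ⊎ OccT v t
FreeIn v (`X t)   = OccT v t
FreeIn v (`¬X t)  = OccT v t
FreeIn v (φ `∧ ψ) = FreeIn v φ ⊎ FreeIn v ψ
FreeIn v (φ `∨ ψ) = FreeIn v φ ⊎ FreeIn v ψ
FreeIn v (`∀ x φ) = ¬ (v ≡ x) × FreeIn v φ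
FreeIn v (`∃ x φ) = ¬ (v ≡ x) × FreeIn v φ

ClosedT : Term → Set
ClosedT t = ∀ v → ¬ OccT v t

Sentence : Formula → Set
Sentence φ = ∀ v → ¬ FreeIn v φ

-- substitution φ[x/t] (only used with closed t, so no capture)
substT : ℕ → Term → Term → Term
substT x t (var w) with x ≟ w
... | yes _ = t
... | no  _ = var w
substT x t `0       = `0
substT x t (`S u)   = `S (substT x t u)
substT x t (u `+ w) = substT x t u `+ substT x t w
substT x t (u `× w) = substT x t u `× substT x t w

subst : ℕ → Term → Formula → Formula
subst x t (u `= w) = substT x t u `= substT x t w
subst x t (u `≠ w) = substT x t u `≠ substT x t w
subst x t (u `≤ w) = substT x t u `≤ substT x t w
subst x t (u `≰ w) = substT x t u `≰ substT x t w
subst x t (`X u)   = `X (substT x t u)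
subst x t (`¬X u)  = `¬X (substT x t u)
subst x t (φ `∧ ψ) = subst x t φ `∧ subst x t ψ
subst x t (φ `∨ ψ) = subst x t φ `∨ subst x t ψ
subst x t (`∀ y φ) with x ≟ y
... | yes _ = `∀ y φ
... | no  _ = `∀ y (subst x t φ)
subst x t (`∃ y φ) with x ≟ y
... | yes _ = `∃ y φ
... | no  _ = `∃ y (subst x t φ)

Env : Set
Env = ℕ → ℕ

_[_↦_] : Env → ℕ → ℕ → Env
(ρ [ x ↦ n ]) y with x ≟ y
... | yes _ = n
... | no  _ = ρ y

evalT : Env → Term → ℕ
evalT ρ (var x)  = ρ x
evalT ρ `0       = 0
evalT ρ (`S t)   = suc (evalT ρ t)
evalT ρ (s `+ t) = evalT ρ s + evalT ρ t
evalT ρ (s `× t) = evalT ρ s * evalT ρ t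

val : Term → ℕ
val = evalT (λ _ → 0)

Sat : (ℕ → Set) → Env → Formula → Set
Sat P ρ (s `= t) = evalT ρ s ≡ evalT ρ t
Sat P ρ (s `≠ t) = ¬ (evalT ρ s ≡ evalT ρ t)
Sat P ρ (s `≤ t) = evalT ρ s ≤ evalT ρ t
Sat P ρ (s `≰ t) = ¬ (evalT ρ s ≤ evalT ρ t)
Sat P ρ (`X t)   = P (evalT ρ t)
Sat P ρ (`¬X t)  = ¬ P (evalT ρ t)
Sat P ρ (φ `∧ ψ) = Sat P ρ φ × Sat P ρ ψ
Sat P ρ (φ `∨ ψ) = Sat P ρ φ ⊎ Sat P ρ ψ
Sat P ρ (`∀ x φ) = ∀ n → Sat P (ρ [ x ↦ n ]) φ
Sat P ρ (`∃ x φ) = Σ ℕ λ n → Sat P (ρ [ x ↦ n ]) φ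

-- truth of an L_PA-sentence in ℕ (X does not occur, so its interpretation is irrelevant)
True : Formula → Set
True φ = Sat (λ _ → ⊥) (λ _ → 0) φ

DefRel : Formula → ℕ → ℕ → ℕ → ℕ → Set
DefRel φ a b m n = Sat (λ _ → ⊥) (((λ _ → 0) [ a ↦ m ]) [ b ↦ n ]) φ

-- Well orders (strict; totality stated classically-neutrally)

record IsWellOrder {A : Set} (_<_ : A → A → Set) : Set where
  field
    irrefl : ∀ x → ¬ (x < x)
    trans  : ∀ {x y z} → x < y → y < z → x < z
    total  : ∀ x y → ¬ (x < y) → ¬ (y < x) → x ≡ y
    wf     : WellFounded _<_

record OrdSys : Set₁ where
  field
    E       : Set
    _≺_     : E → E → Set
    isWO    : IsWellOrder _≺_
    _+1     : E → E
    𝟎       : E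
    ω       : E
    ≺+1     : ∀ α → α ≺ (α +1)
    0≺ω     : 𝟎 ≺ ω
    ω-limit : ∀ α → α ≺ ω → (α +1) ≺ ω

-- The infinitary calculus ⊢^α_d Γ.
-- Sequents are lists, used only through membership and ⊆ (i.e. as finite sets).

module Calculus (𝔼 : OrdSys) (_◁_ : ℕ → ℕ → Set) where
  open OrdSys 𝔼

  Sequent : Set
  Sequent = List Formula

  mutual
    record Prem (α : E) (d : ℕ) (Γ : Sequent) (φ : Formula) : Set where
      inductive
      field
        α'    : E
        α'≺α  : α' ≺ α
        d'    : ℕ
        d'≤d  : d' ≤ d
        Δ     : Sequent
        Δ⊆    : Δ ⊆ (φ ∷ Γ)
        deriv : ⊢ α' d' Δ

    data ⊢ : E → ℕ → Sequent → Set where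
      ax-lit : ∀ {α d Γ ℓ} → ℓ ∈ Γ → IsLiteral ℓ → NoX ℓ → Sentence ℓ → True ℓ → ⊢ α d Γ
      ax-X   : ∀ {α d Γ s t} → `X s ∈ Γ → `¬X t ∈ Γ → ClosedT s → ClosedT t →
               val s ≡ val t → ⊢ α d Γ
      r-∧    : ∀ {α d Γ φ₀ φ₁} → (φ₀ `∧ φ₁) ∈ Γ →
               Prem α d Γ φ₀ → Prem α d Γ φ₁ → ⊢ α d Γ
      r-∨₀   : ∀ {α d Γ φ₀ φ₁} → (φ₀ `∨ φ₁) ∈ Γ → Prem α d Γ φ₀ → ⊢ α d Γ
      r-∨₁   : ∀ {α d Γ φ₀ φ₁} → (φ₀ `∨ φ₁) ∈ Γ → Prem α d Γ φ₁ → ⊢ α d Γ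
      r-∀    : ∀ {α d Γ x φ} → `∀ x φ ∈ Γ →
               ((t : Term) → ClosedT t → Prem α d Γ (subst x t φ)) → ⊢ α d Γ
      r-∃    : ∀ {α d Γ x φ} → `∃ x φ ∈ Γ →
               (t : Term) → ClosedT t → Prem α d Γ (subst x t φ) → ⊢ α d Γ
      r-X    : ∀ {α d Γ t} → `X t ∈ Γ →
               ((s : Term) → ClosedT s → val s ◁ val t → Prem α d Γ (`X s)) → ⊢ α d Γ
      r-cut  : ∀ {α d Γ} (φ : Formula) → Sentence φ → rk φ < d →
               Prem α d Γ φ → Prem α d Γ (neg φ) → ⊢ α d Γ

-- Prog_◁ :≡ ∀x(∃y(y ◁ x ∧ ¬Xy) ∨ Xx), where the formula `lt` has free
-- variables a, b and expresses a ◁ b; here y is named a and x is named b.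

Prog : Formula → ℕ → ℕ → Formula
Prog lt a b = `∀ b ((`∃ a (lt `∧ `¬X (var a))) `∨ `X (var b))

{-# OPTIONS --safe #-}
-- Fix a closed term t. Choosing the disjunct Xt and applying the progressiveness
-- rule (iv) to it leaves, for every s ◁ t, the sequent with Xs and ∃y(y ◁ t ∧ ¬Xy);
-- taking s as the witness, the conjunct s ◁ t is a true L_PA-sentence, derivable
-- without cuts in rk(◁) steps, and ¬Xs closes against Xs. The height of the whole
-- derivation is the finite ordinal rk(◁) + 6, independent of t, hence below ω.
module Submission where

open import Defs
open import Data.Nat using (ℕ; zero; suc; _+_; _*_; _≤_; _⊔_; s≤s)
open import Data.Nat.Properties using (_≟_; ≤-refl; ≤-trans; ≤-reflexive; m≤m⊔n; m≤n⊔m)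
open import Data.Sum using (_⊎_; inj₁; inj₂; [_,_])
open import Data.Product using (Σ; _×_; _,_; map₁)
open import Data.List using (_∷_; [])
open import Data.List.Relation.Unary.Any using (here; there)
open import Data.List.Membership.Propositional using (_∈_)
open import Data.Empty using (⊥-elim)
open import Data.Unit using (tt)
open import Function using (_∘_)
open import Relation.Nullary using (¬_; Dec; yes; no)
open import Relation.Binary.PropositionalEquality
  using (_≡_; _≢_; _≗_; refl; sym; trans; cong; cong₂; subst₂)
  renaming (subst to ≡-subst)

update-cong : ∀ {ρ ρ′} → ρ ≗ ρ′ → ∀ x n → ρ [ x ↦ n ] ≗ ρ′ [ x ↦ n ]
update-cong e x n v with x ≟ v
... | yes _ = refl
... | no  _ = e v

update-≡ : ∀ ρ {x v} m → x ≡ v → (ρ [ x ↦ m ]) v ≡ m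
update-≡ ρ {x} {v} m x≡v with x ≟ v
... | yes _   = refl
... | no x≢v = ⊥-elim (x≢v x≡v)

update-≢ : ∀ ρ {x v} m → x ≢ v → (ρ [ x ↦ m ]) v ≡ ρ v
update-≢ ρ {x} {v} m x≢v with x ≟ v
... | yes x≡v = ⊥-elim (x≢v x≡v)
... | no _    = refl

update-comm : ∀ ρ {x y} → x ≢ y → ∀ m n → (ρ [ y ↦ n ]) [ x ↦ m ] ≗ (ρ [ x ↦ m ]) [ y ↦ n ]
update-comm ρ {x} {y} x≢y m n v = by-cases (x ≟ v) (y ≟ v)
  where
  by-cases : Dec (x ≡ v) → Dec (y ≡ v) → ((ρ [ y ↦ n ]) [ x ↦ m ]) v ≡ ((ρ [ x ↦ m ]) [ y ↦ n ]) v
  by-cases (yes refl) (yes refl) = ⊥-elim (x≢y refl)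
  by-cases (yes x≡v) (no y≢v) =
    trans (update-≡ _ m x≡v) (sym (trans (update-≢ _ n y≢v) (update-≡ ρ m x≡v)))
  by-cases (no x≢v) (yes y≡v) =
    trans (update-≢ _ m x≢v) (trans (update-≡ ρ n y≡v) (sym (update-≡ _ n y≡v)))
  by-cases (no x≢v) (no y≢v) =
    trans (update-≢ _ m x≢v) (trans (update-≢ ρ n y≢v) (sym (trans (update-≢ _ n y≢v) (update-≢ ρ m x≢v))))

update-idem : ∀ ρ x m n → (ρ [ x ↦ m ]) [ x ↦ n ] ≗ ρ [ x ↦ n ]
update-idem ρ x m n v = by-cases (x ≟ v)
  where
  by-cases : Dec (x ≡ v) → ((ρ [ x ↦ m ]) [ x ↦ n ]) v ≡ (ρ [ x ↦ n ]) v
  by-cases (yes x≡v) = trans (update-≡ _ n x≡v) (sym (update-≡ ρ n x≡v))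
  by-cases (no x≢v)  = trans (update-≢ _ n x≢v) (trans (update-≢ ρ m x≢v) (sym (update-≢ ρ n x≢v)))

evalT-cong : ∀ {ρ ρ′} → ρ ≗ ρ′ → ∀ u → evalT ρ u ≡ evalT ρ′ u
evalT-cong e (var x)  = e x
evalT-cong e `0       = refl
evalT-cong e (`S u)   = cong suc (evalT-cong e u)
evalT-cong e (u `+ w) = cong₂ _+_ (evalT-cong e u) (evalT-cong e w)
evalT-cong e (u `× w) = cong₂ _*_ (evalT-cong e u) (evalT-cong e w)

Sat-resp-≗ : ∀ {P ρ ρ′} → ρ ≗ ρ′ → ∀ φ → Sat P ρ φ → Sat P ρ′ φ
Sat-resp-≗ e (s `= t) h    = trans (sym (evalT-cong e s)) (trans h (evalT-cong e t))
Sat-resp-≗ e (s `≠ t) h h′ = h (trans (evalT-cong e s) (trans h′ (sym (evalT-cong e t))))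
Sat-resp-≗ e (s `≤ t) h    = subst₂ _≤_ (evalT-cong e s) (evalT-cong e t) h
Sat-resp-≗ e (s `≰ t) h h′ = h (subst₂ _≤_ (sym (evalT-cong e s)) (sym (evalT-cong e t)) h′)
Sat-resp-≗ {P} e (`X t) h     = ≡-subst P (evalT-cong e t) h
Sat-resp-≗ {P} e (`¬X t) h h′ = h (≡-subst P (sym (evalT-cong e t)) h′)
Sat-resp-≗ e (φ `∧ ψ) (h , h′) = Sat-resp-≗ e φ h , Sat-resp-≗ e ψ h′
Sat-resp-≗ e (φ `∨ ψ) (inj₁ h) = inj₁ (Sat-resp-≗ e φ h)
Sat-resp-≗ e (φ `∨ ψ) (inj₂ h) = inj₂ (Sat-resp-≗ e ψ h)
Sat-resp-≗ e (`∀ x φ) h n     = Sat-resp-≗ (update-cong e x n) φ (h n)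
Sat-resp-≗ e (`∃ x φ) (n , h) = n , Sat-resp-≗ (update-cong e x n) φ h

evalT-closed : ∀ {ρ ρ′} t → ClosedT t → evalT ρ t ≡ evalT ρ′ t
evalT-closed (var w)  c = ⊥-elim (c w refl)
evalT-closed `0       c = refl
evalT-closed (`S t)   c = cong suc (evalT-closed t c)
evalT-closed (u `+ w) c = cong₂ _+_ (evalT-closed u (λ v → c v ∘ inj₁)) (evalT-closed w (λ v → c v ∘ inj₂))
evalT-closed (u `× w) c = cong₂ _*_ (evalT-closed u (λ v → c v ∘ inj₁)) (evalT-closed w (λ v → c v ∘ inj₂))

evalT-substT : ∀ ρ x t u → evalT ρ (substT x t u) ≡ evalT (ρ [ x ↦ evalT ρ t ]) u
evalT-substT ρ x t (var w) with x ≟ w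
... | yes _ = refl
... | no  _ = refl
evalT-substT ρ x t `0       = refl
evalT-substT ρ x t (`S u)   = cong suc (evalT-substT ρ x t u)
evalT-substT ρ x t (u `+ w) = cong₂ _+_ (evalT-substT ρ x t u) (evalT-substT ρ x t w)
evalT-substT ρ x t (u `× w) = cong₂ _*_ (evalT-substT ρ x t u) (evalT-substT ρ x t w)

-- Pushing the substitution under a binder y ≢ x is sound because t is closed,
-- so its value does not change when y is rebound.
update-under-binder : ∀ ρ {x y} t → ClosedT t → x ≢ y → ∀ n →
  (ρ [ x ↦ evalT ρ t ]) [ y ↦ n ] ≗ (ρ [ y ↦ n ]) [ x ↦ evalT (ρ [ y ↦ n ]) t ]
update-under-binder ρ {x} {y} t c x≢y n v =
  trans (sym (update-comm ρ x≢y (evalT ρ t) n v))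
        (cong (λ k → ((ρ [ y ↦ n ]) [ x ↦ k ]) v) (evalT-closed t c))

Sat-subst : ∀ {P} ρ x t → ClosedT t → ∀ φ → Sat P (ρ [ x ↦ evalT ρ t ]) φ → Sat P ρ (subst x t φ)
Sat-subst ρ x t c (u `= w) h    = trans (evalT-substT ρ x t u) (trans h (sym (evalT-substT ρ x t w)))
Sat-subst ρ x t c (u `≠ w) h h′ = h (trans (sym (evalT-substT ρ x t u)) (trans h′ (evalT-substT ρ x t w)))
Sat-subst ρ x t c (u `≤ w) h    = subst₂ _≤_ (sym (evalT-substT ρ x t u)) (sym (evalT-substT ρ x t w)) h
Sat-subst ρ x t c (u `≰ w) h h′ = h (subst₂ _≤_ (evalT-substT ρ x t u) (evalT-substT ρ x t w) h′)
Sat-subst {P} ρ x t c (`X u) h     = ≡-subst P (sym (evalT-substT ρ x t u)) h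
Sat-subst {P} ρ x t c (`¬X u) h h′ = h (≡-subst P (evalT-substT ρ x t u) h′)
Sat-subst ρ x t c (φ `∧ ψ) (h , h′) = Sat-subst ρ x t c φ h , Sat-subst ρ x t c ψ h′
Sat-subst ρ x t c (φ `∨ ψ) (inj₁ h) = inj₁ (Sat-subst ρ x t c φ h)
Sat-subst ρ x t c (φ `∨ ψ) (inj₂ h) = inj₂ (Sat-subst ρ x t c ψ h)
Sat-subst ρ x t c (`∀ y φ) h with x ≟ y
... | yes refl = λ n → Sat-resp-≗ (update-idem ρ x _ n) φ (h n)
... | no x≢y   = λ n → Sat-subst (ρ [ y ↦ n ]) x t c φ
                         (Sat-resp-≗ (update-under-binder ρ t c x≢y n) φ (h n))
Sat-subst ρ x t c (`∃ y φ) h with x ≟ y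
Sat-subst ρ x t c (`∃ y φ) (n , h) | yes refl = n , Sat-resp-≗ (update-idem ρ x _ n) φ h
Sat-subst ρ x t c (`∃ y φ) (n , h) | no x≢y   =
  n , Sat-subst (ρ [ y ↦ n ]) x t c φ (Sat-resp-≗ (update-under-binder ρ t c x≢y n) φ h)

DefRel⇒True-subst : ∀ φ a b s t → ClosedT s → ClosedT t →
                    DefRel φ a b (val s) (val t) → True (subst a s (subst b t φ))
DefRel⇒True-subst φ a b s t cs ct h =
  Sat-subst _ a s cs (subst b t φ) (Sat-subst ρ b t ct φ (Sat-resp-≗ val-t≡ φ h))
  where
  ρ = (λ _ → 0) [ a ↦ val s ]
  val-t≡ : ρ [ b ↦ val t ] ≗ ρ [ b ↦ evalT ρ t ]
  val-t≡ v = cong (λ k → (ρ [ b ↦ k ]) v) (evalT-closed t ct)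

mutual
  OccT-substT : ∀ {v} x t → ClosedT t → ∀ u → OccT v (substT x t u) → OccT v u × v ≢ x
  OccT-substT x t c (var w) o with x ≟ w
  ... | yes _   = ⊥-elim (c _ o)
  ... | no x≢w = o , λ v≡x → x≢w (trans (sym v≡x) o)
  OccT-substT x t c `0 ()
  OccT-substT x t c (`S u)   o = OccT-substT x t c u o
  OccT-substT x t c (u `+ w) o = OccT-substT₂ x t c u w o
  OccT-substT x t c (u `× w) o = OccT-substT₂ x t c u w o

  OccT-substT₂ : ∀ {v} x t → ClosedT t → ∀ u w →
                 OccT v (substT x t u) ⊎ OccT v (substT x t w) → (OccT v u ⊎ OccT v w) × v ≢ x
  OccT-substT₂ x t c u w = [ map₁ inj₁ ∘ OccT-substT x t c u , map₁ inj₂ ∘ OccT-substT x t c w ]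

FreeIn-subst : ∀ {v} x t → ClosedT t → ∀ φ → FreeIn v (subst x t φ) → FreeIn v φ × v ≢ x
FreeIn-subst x t c (u `= w) = OccT-substT₂ x t c u w
FreeIn-subst x t c (u `≠ w) = OccT-substT₂ x t c u w
FreeIn-subst x t c (u `≤ w) = OccT-substT₂ x t c u w
FreeIn-subst x t c (u `≰ w) = OccT-substT₂ x t c u w
FreeIn-subst x t c (`X u)   = OccT-substT x t c u
FreeIn-subst x t c (`¬X u)  = OccT-substT x t c u
FreeIn-subst x t c (φ `∧ ψ) = [ map₁ inj₁ ∘ FreeIn-subst x t c φ , map₁ inj₂ ∘ FreeIn-subst x t c ψ ]
FreeIn-subst x t c (φ `∨ ψ) = [ map₁ inj₁ ∘ FreeIn-subst x t c φ , map₁ inj₂ ∘ FreeIn-subst x t c ψ ]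
FreeIn-subst x t c (`∀ y φ) f with x ≟ y
FreeIn-subst x t c (`∀ y φ) (v≢x , f) | yes refl = (v≢x , f) , v≢x
FreeIn-subst x t c (`∀ y φ) (v≢y , f) | no _     = map₁ (v≢y ,_) (FreeIn-subst x t c φ f)
FreeIn-subst x t c (`∃ y φ) f with x ≟ y
FreeIn-subst x t c (`∃ y φ) (v≢x , f) | yes refl = (v≢x , f) , v≢x
FreeIn-subst x t c (`∃ y φ) (v≢y , f) | no _     = map₁ (v≢y ,_) (FreeIn-subst x t c φ f)

subst-sentence : ∀ x t φ → ClosedT t → (∀ v → v ≢ x → ¬ FreeIn v φ) → Sentence (subst x t φ)
subst-sentence x t φ c only-x v f with FreeIn-subst x t c φ f
... | f′ , v≢x = only-x v v≢x f′

subst₂-sentence : ∀ φ a b s t → ClosedT s → ClosedT t →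
                  (∀ v → FreeIn v φ → v ≡ a ⊎ v ≡ b) → Sentence (subst a s (subst b t φ))
subst₂-sentence φ a b s t cs ct fv v f with FreeIn-subst a s cs (subst b t φ) f
... | f′ , v≢a with FreeIn-subst b t ct φ f′
...   | f″ , v≢b = [ v≢a , v≢b ] (fv v f″)

NoX-subst : ∀ x t φ → NoX φ → NoX (subst x t φ)
NoX-subst x t (u `= w) _ = tt
NoX-subst x t (u `≠ w) _ = tt
NoX-subst x t (u `≤ w) _ = tt
NoX-subst x t (u `≰ w) _ = tt
NoX-subst x t (φ `∧ ψ) (nφ , nψ) = NoX-subst x t φ nφ , NoX-subst x t ψ nψ
NoX-subst x t (φ `∨ ψ) (nφ , nψ) = NoX-subst x t φ nφ , NoX-subst x t ψ nψ
NoX-subst x t (`∀ y φ) nφ with x ≟ y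
... | yes _ = nφ
... | no  _ = NoX-subst x t φ nφ
NoX-subst x t (`∃ y φ) nφ with x ≟ y
... | yes _ = nφ
... | no  _ = NoX-subst x t φ nφ

rk-subst : ∀ x t φ → rk (subst x t φ) ≡ rk φ
rk-subst x t (u `= w) = refl
rk-subst x t (u `≠ w) = refl
rk-subst x t (u `≤ w) = refl
rk-subst x t (u `≰ w) = refl
rk-subst x t (`X u)   = refl
rk-subst x t (`¬X u)  = refl
rk-subst x t (φ `∧ ψ) = cong suc (cong₂ _⊔_ (rk-subst x t φ) (rk-subst x t ψ))
rk-subst x t (φ `∨ ψ) = cong suc (cong₂ _⊔_ (rk-subst x t φ) (rk-subst x t ψ))
rk-subst x t (`∀ y φ) with x ≟ y
... | yes _ = refl
... | no  _ = cong suc (rk-subst x t φ)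
rk-subst x t (`∃ y φ) with x ≟ y
... | yes _ = refl
... | no  _ = cong suc (rk-subst x t φ)

substT-var-≡ : ∀ x t → substT x t (var x) ≡ t
substT-var-≡ x t with x ≟ x
... | yes _   = refl
... | no x≢x = ⊥-elim (x≢x refl)

substT-var-≢ : ∀ {x y} t → x ≢ y → substT x t (var y) ≡ var y
substT-var-≢ {x} {y} t x≢y with x ≟ y
... | yes x≡y = ⊥-elim (x≢y x≡y)
... | no  _   = refl

subst-∃-≢ : ∀ {x y} t φ → x ≢ y → subst x t (`∃ y φ) ≡ `∃ y (subst x t φ)
subst-∃-≢ {x} {y} t φ x≢y with x ≟ y
... | yes x≡y = ⊥-elim (x≢y x≡y)
... | no  _   = refl

numeral : ℕ → Term
numeral zero    = `0
numeral (suc k) = `S (numeral k)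

numeral-closed : ∀ k → ClosedT (numeral k)
numeral-closed zero    v ()
numeral-closed (suc k) v o = numeral-closed k v o

val-numeral : ∀ k → val (numeral k) ≡ k
val-numeral zero    = refl
val-numeral (suc k) = cong suc (val-numeral k)

module Derivations (𝔼 : OrdSys) (_◁_ : ℕ → ℕ → Set) where
  open OrdSys 𝔼
  open Calculus 𝔼 _◁_

  finite : ℕ → E
  finite zero    = 𝟎
  finite (suc n) = finite n +1

  finite≺ω : ∀ n → finite n ≺ ω
  finite≺ω zero    = 0≺ω
  finite≺ω (suc n) = ω-limit _ (finite≺ω n)

  premise : ∀ n {d Γ φ} → ⊢ (finite n) d (φ ∷ Γ) → Prem (finite (suc n)) d Γ φ
  premise n {d} D = record
    { α' = finite n ; α'≺α = ≺+1 (finite n) ; d' = d ; d'≤d = ≤-refl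
    ; Δ = _ ; Δ⊆ = λ m → m ; deriv = D }

  ⊢-true : ∀ n {d Γ} φ → NoX φ → Sentence φ → True φ → rk φ ≤ n → φ ∈ Γ → ⊢ (finite n) d Γ
  ⊢-true n (s `= t) nx sen tr _ m = ax-lit m lit-= nx sen tr
  ⊢-true n (s `≠ t) nx sen tr _ m = ax-lit m lit-≠ nx sen tr
  ⊢-true n (s `≤ t) nx sen tr _ m = ax-lit m lit-≤ nx sen tr
  ⊢-true n (s `≰ t) nx sen tr _ m = ax-lit m lit-≰ nx sen tr
  ⊢-true (suc n) (φ₀ `∧ φ₁) (nx₀ , nx₁) sen (t₀ , t₁) (s≤s r) m =
    r-∧ m (premise n (⊢-true n φ₀ nx₀ (λ v → sen v ∘ inj₁) t₀ (≤-trans (m≤m⊔n _ _) r) (here refl)))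
          (premise n (⊢-true n φ₁ nx₁ (λ v → sen v ∘ inj₂) t₁ (≤-trans (m≤n⊔m _ _) r) (here refl)))
  ⊢-true (suc n) (φ₀ `∨ φ₁) (nx₀ , _) sen (inj₁ t₀) (s≤s r) m =
    r-∨₀ m (premise n (⊢-true n φ₀ nx₀ (λ v → sen v ∘ inj₁) t₀ (≤-trans (m≤m⊔n _ _) r) (here refl)))
  ⊢-true (suc n) (φ₀ `∨ φ₁) (_ , nx₁) sen (inj₂ t₁) (s≤s r) m =
    r-∨₁ m (premise n (⊢-true n φ₁ nx₁ (λ v → sen v ∘ inj₂) t₁ (≤-trans (m≤n⊔m _ _) r) (here refl)))
  ⊢-true (suc n) (`∀ x φ) nx sen tr (s≤s r) m =
    r-∀ m λ t c → premise n (⊢-true n (subst x t φ) (NoX-subst x t φ nx)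
      (subst-sentence x t φ c λ v v≢x f → sen v (v≢x , f))
      (Sat-subst _ x t c φ (tr (val t))) (≤-trans (≤-reflexive (rk-subst x t φ)) r) (here refl))
  ⊢-true (suc n) (`∃ x φ) nx sen (k , tr) (s≤s r) m =
    r-∃ m (numeral k) c (premise n (⊢-true n (subst x (numeral k) φ)
      (NoX-subst x (numeral k) φ nx) (subst-sentence x (numeral k) φ c λ v v≢x f → sen v (v≢x , f))
      (Sat-subst _ x (numeral k) c φ (≡-subst (λ j → Sat _ (_ [ x ↦ j ]) φ) (sym (val-numeral k)) tr))
      (≤-trans (≤-reflexive (rk-subst x (numeral k) φ)) r) (here refl)))
    where
    c : ClosedT (numeral k)
    c = numeral-closed k

  ⊢-∃-counterexample : ∀ n {d Γ} x φ s → ClosedT s → NoX (subst x s φ) → Sentence (subst x s φ) →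
                       True (subst x s φ) → rk φ ≤ n →
                       `∃ x (φ `∧ `¬X (var x)) ∈ Γ → `X s ∈ Γ → ⊢ (finite (2 + n)) d Γ
  ⊢-∃-counterexample n x φ s cs nx sen tr r ∃∈ X∈ =
    r-∃ ∃∈ s cs (premise (1 + n) (r-∧ (here refl)
      (premise n (⊢-true n (subst x s φ) nx sen tr (≤-trans (≤-reflexive (rk-subst x s φ)) r) (here refl)))
      (premise n (ax-X (there (there X∈)) (here refl) cs
        (≡-subst ClosedT (sym (substT-var-≡ x s)) cs) (cong val (sym (substT-var-≡ x s)))))))

lemma3p9 : (𝔼 : OrdSys) (lt : Formula) (a b : ℕ) → ¬ (a ≡ b) →
    NoX lt → (∀ v → FreeIn v lt → (v ≡ a) ⊎ (v ≡ b)) →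
    IsWellOrder (DefRel lt a b) →
    Σ (OrdSys.E 𝔼) (λ α → OrdSys._≺_ 𝔼 α (OrdSys.ω 𝔼) ×
    Calculus.⊢ 𝔼 (DefRel lt a b) α 0 (Prog lt a b ∷ []))
lemma3p9 𝔼 lt a b a≢b nx fv _ =
  finite (6 + n) , finite≺ω (6 + n) , r-∀ (here refl) λ t c → premise (5 + n) (progressive-at t c)
  where
  open Calculus 𝔼 (DefRel lt a b)
  open Derivations 𝔼 (DefRel lt a b)
  n : ℕ
  n = rk lt

  ∃¬X : Formula
  ∃¬X = `∃ a (lt `∧ `¬X (var a))

  b≢a : b ≢ a
  b≢a = a≢b ∘ sym

  counterexample : ∀ {Γ} t s → ClosedT t → ClosedT s → DefRel lt a b (val s) (val t) →
                   subst b t ∃¬X ∈ Γ → `X s ∈ Γ → ⊢ (finite (2 + n)) 0 Γ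
  counterexample t s c cs s◁t ∃∈ =
    ⊢-∃-counterexample n a (subst b t lt) s cs
      (NoX-subst a s (subst b t lt) (NoX-subst b t lt nx)) (subst₂-sentence lt a b s t cs c fv)
      (DefRel⇒True-subst lt a b s t cs c s◁t) (≤-reflexive (rk-subst b t lt))
      (≡-subst (_∈ _) ∃-instance ∃∈)
    where
    ∃-instance : subst b t ∃¬X ≡ `∃ a (subst b t lt `∧ `¬X (var a))
    ∃-instance = trans (subst-∃-≢ t _ b≢a) (cong (λ u → `∃ a (subst b t lt `∧ `¬X u)) (substT-var-≢ t b≢a))

  progressive-at : ∀ t → ClosedT t → ⊢ (finite (5 + n)) 0 (subst b t (∃¬X `∨ `X (var b)) ∷ Prog lt a b ∷ [])
  progressive-at t c =
    r-∨₁ (here refl) (premise (4 + n) (r-∨₀ (there (here refl)) (premise (3 + n)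
      (r-X (there (here refl)) λ s cs s◁t → premise (2 + n)
        (counterexample t s c cs (≡-subst (DefRel lt a b (val s) ∘ val) (substT-var-≡ b t) s◁t)
          (there (here refl)) (here refl))))))
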